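{- Let $\mathcal{F}$ be an unsatisfiable CNF formula, let $a_i$ be a complete assignment to the variables of $\mathcal{F}$, and let $c_i$ be a clause with $c_i \in \mathrm{Unsat}(\mathcal{F},a_i)$. Then for every clause $c_j \in \mathcal{F}$ with $A(c_j,\mathcal{F}) \neq \emptyset$ there exists a directed path in the rotation graph $\mathcal{R}_{\mathcal{F}}$ starting from the vertex $a_i$ and ending at some assoc $a_j \in A(c_j,\mathcal{F})$.
   Context: A literal is a Boolean variable $x$ or its negation $\lnot x$, with $\lnot\lnot l = l$. A clause is a non-empty set of literals (a disjunction); a CNF formula $\mathcal{F}$ is a set of clauses (a conjunction). An assignment is a set of literals $a$ such that $l \in a$ implies $\lnot l \notin a$. The assignment $a$ satisfies a clause $c$ if $a \cap c \neq \emptyset$, and satisfies a formula if it satisfies all of its clauses. A complete assignment to the variables of $\mathcal{F}$ is an assignment containing, for each variable $x$ occurring in $\mathcal{F}$, exactly one of $x, \lnot x$ (and no other literals). An associated assignment (assoc) for a clause $c \in \mathcal{F}$ is a complete assignment that satisfies $\mathcal{F} \setminus \{c\}$ and does not satisfy $c$. The set of all assocs for $c$ is denoted $A(c,\mathcal{F})$. For an assignment $a$ and a literal $l$, define $\mathrm{flip}(a,l) = (a \setminus \{l\}) \cup \{\lnot l\}$. For an assignment $a$, $\mathrm{Unsat}(\mathcal{F},a) = \{ c \in \mathcal{F} \mid c \cap a = \emptyset\}$, and $\bigcup \mathrm{Unsat}(\mathcal{F},a)$ is the set of all literals occurring in these clauses. The rotation graph $\mathcal{R}_{\mathcal{F}}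 = (V_R,E_R)$ of an unsatisfiable formula $\mathcal{F}$ is the directed graph whose vertices are the complete assignments to the variables of $\mathcal{F}$, with an edge $(a,a') \in E_R$ whenever $a' = \mathrm{flip}(a,\lnot l)$ for some literal $l \in \bigcup \mathrm{Unsat}(\mathcal{F},a)$. -}

module Defs where

open import Data.Nat using (ℕ)
open import Data.Fin using (Fin)
open import Data.Bool using (Bool; true; false; not)
open import Data.Product using (_×_; _,_; proj₁; proj₂; Σ; ∃; ∃-syntax)
open import Data.Sum using (_⊎_)
open import Data.Vec using (Vec; lookup; updateAt)
open import Data.List using (List)
open import Data.List.Membership.Propositional using (_∈_)
open import Data.List.Relation.Unary.All using (All)
open import Relation.Nullary using (¬_)
open import Relation.Binary.PropositionalEquality using (_≡_; _≢_)
open import Relation.Binary.Construct.Closure.ReflexiveTransitive using (Star)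

-- Variables are Fin n.  A literal is a variable with a polarity
-- (true = positive literal x, false = negative literal ¬x).
Lit : ℕ → Set
Lit n = Fin n × Bool

neg : ∀ {n} → Lit n → Lit n
neg (x , p) = (x , not p)

-- A (finite) set of literals over variables Fin n: for each variable x,
-- the pair (x ∈ s , ¬x ∈ s).  Propositional equality is set equality.
LitSet : ℕ → Set
LitSet n = Vec (Bool × Bool) n

flag : Bool → Bool × Bool → Bool
flag true  = proj₁
flag false = proj₂

_∈L_ : ∀ {n} → Lit n → LitSet n → Set
(x , p) ∈L s = flag p (lookup s x) ≡ true

_∉L_ : ∀ {n} → Lit n → LitSet n → Set
l ∉L s = ¬ (l ∈L s)

-- clauses, formulas (a list read as a set of clauses), assignments
Clause : ℕ → Set
Clause = LitSet

Formula : ℕ → Set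
Formula n = List (Clause n)

Assignment : ℕ → Set
Assignment = LitSet

NonEmptyClause : ∀ {n} → Clause n → Set
NonEmptyClause {n} c = ∃[ l ] (l ∈L c)

WellFormed : ∀ {n} → Formula n → Set
WellFormed F = All NonEmptyClause F

Occurs : ∀ {n} → Fin n → Formula n → Set
Occurs x F = ∃[ c ] (c ∈ F × (((x , true) ∈L c) ⊎ ((x , false) ∈L c)))

IsAssignment : ∀ {n} → LitSet n → Set
IsAssignment {n} a = (l : Lit n) → l ∈L a → neg l ∉L a

Complete : ∀ {n} → Formula n → Assignment n → Set
Complete {n} F a =
  IsAssignment a ×
  ((x : Fin n) → Occurs x F → ((x , true) ∈L a) ⊎ ((x , false) ∈L a)) ×
  ((l : Lit n) → l ∈L a → Occurs (proj₁ l) F)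

SatClause : ∀ {n} → Assignment n → Clause n → Set
SatClause a c = ∃[ l ] (l ∈L a × l ∈L c)

SatFormula : ∀ {n} → Assignment n → Formula n → Set
SatFormula a F = ∀ c → c ∈ F → SatClause a c

Unsatisfiable : ∀ {n} → Formula n → Set
Unsatisfiable F = ¬ (∃[ a ] (Complete F a × SatFormula a F))

InUnsat : ∀ {n} → Formula n → Assignment n → Clause n → Set
InUnsat F a c = c ∈ F × ¬ SatClause a c

InUnionUnsat : ∀ {n} → Formula n → Assignment n → Lit n → Set
InUnionUnsat F a l = ∃[ c ] (InUnsat F a c × l ∈L c)

IsAssoc : ∀ {n} → Formula n → Clause n → Assignment n → Set
IsAssoc F c a =
  Complete F a ×
  (∀ c′ → c′ ∈ F → c′ ≢ c → SatClause a c′) ×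
  ¬ SatClause a c

setFlag : Bool → Bool → Bool × Bool → Bool × Bool
setFlag true  b (u , v) = (b , v)
setFlag false b (u , v) = (u , b)

-- flip(a, l) = (a ∖ {l}) ∪ {¬l}
flip : ∀ {n} → LitSet n → Lit n → LitSet n
flip a (x , p) = updateAt a x (λ q → setFlag (not p) true (setFlag p false q))

RotEdge : ∀ {n} → Formula n → Assignment n → Assignment n → Set
RotEdge F a a′ =
  Complete F a × Complete F a′ ×
  ∃[ l ] (InUnionUnsat F a l × a′ ≡ flip a (neg l))

RotPath : ∀ {n} → Formula n → Assignment n → Assignment n → Set
RotPath F = Star (RotEdge F)

-- Fix an assoc b of cⱼ and walk from aᵢ towards b.  If the current complete
-- assignment a leaves some clause c ≠ cⱼ unsatisfied, then b satisfies c
-- through a literal l ∉ a; since ¬l ∈ a, the clause c licenses the rotation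
-- edge flipping ¬l, which makes a agree with b on one more variable.
-- Otherwise a satisfies every clause but cⱼ, and as F is unsatisfiable it
-- cannot satisfy cⱼ: a is itself an assoc of cⱼ.  The Hamming distance to b
-- strictly decreases along the walk, so it ends.
module Submission where

open import Defs
open import Data.Nat using (ℕ; suc; _<_; s≤s)
open import Data.Nat.Properties using (≤-refl)
open import Data.Nat.Induction using (<-wellFounded)
open import Data.Product using (_×_; ∃; ∃-syntax; _,_; proj₁; proj₂)
open import Data.Product.Properties using () renaming (≡-dec to ×-≡-dec)
open import Data.Sum using (_⊎_; inj₁; inj₂)
open import Data.Bool using (Bool; true; false; not)
open import Data.Bool.Properties using () renaming (_≟_ to _≟B_)
open import Data.Fin using (Fin; zero; suc)
open import Data.Fin.Properties using (any?) renaming (_≟_ to _≟F_)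
open import Data.Vec using (Vec; []; _∷_; lookup; updateAt)
open import Data.Vec.Properties using (lookup∘updateAt; lookup∘updateAt′)
  renaming (≡-dec to Vec-≡-dec)
open import Data.List.Relation.Unary.Any using () renaming (any? to anyᴸ?)
open import Data.List.Membership.Propositional using (_∈_; find; lose)
open import Data.Empty using (⊥-elim)
open import Relation.Binary.Definitions using (DecidableEquality)
open import Relation.Nullary using (¬_; Dec; yes; no)
open import Relation.Nullary.Decidable using (_×-dec_; _⊎-dec_; ¬?)
open import Relation.Binary.PropositionalEquality
  using (_≡_; _≢_; refl; sym; trans; subst)
open import Induction.WellFounded using (Acc; acc)
open import Relation.Binary.Construct.Closure.ReflexiveTransitive using (ε; _◅_)

module Hamming {A : Set} (_≟_ : DecidableEquality A) where

  hamming : ∀ {n} → Vec A n → Vec A n → ℕ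
  hamming []       []       = 0
  hamming (u ∷ us) (v ∷ vs) with u ≟ v
  ... | yes _ = hamming us vs
  ... | no  _ = suc (hamming us vs)

  hamming-updateAt-< : ∀ {n} (xs ys : Vec A n) (i : Fin n) {f : A → A} →
                       f (lookup xs i) ≡ lookup ys i → lookup xs i ≢ lookup ys i →
                       hamming (updateAt xs i f) ys < hamming xs ys
  hamming-updateAt-< (u ∷ us) (v ∷ vs) zero {f} fu≡v u≢v with u ≟ v | f u ≟ v
  ... | yes u≡v | _        = ⊥-elim (u≢v u≡v)
  ... | no  _   | no fu≢v  = ⊥-elim (fu≢v fu≡v)
  ... | no  _   | yes _    = ≤-refl
  hamming-updateAt-< (u ∷ us) (v ∷ vs) (suc i) fx≡y x≢y with u ≟ v
  ... | yes _ = hamming-updateAt-< us vs i fx≡y x≢y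
  ... | no  _ = s≤s (hamming-updateAt-< us vs i fx≡y x≢y)

_≟ᶠ_ : DecidableEquality (Bool × Bool)
_≟ᶠ_ = ×-≡-dec _≟B_ _≟B_

_≟ᶜ_ : ∀ {n} → DecidableEquality (Clause n)
_≟ᶜ_ = Vec-≡-dec _≟ᶠ_

open Hamming _≟ᶠ_

_∈L?_ : ∀ {n} (l : Lit n) (s : LitSet n) → Dec (l ∈L s)
(x , p) ∈L? s = flag p (lookup s x) ≟B true

satClause? : ∀ {n} (a c : Assignment n) → Dec (SatClause a c)
satClause? a c with any? (λ x → ((x , true)  ∈L? a ×-dec (x , true)  ∈L? c)
                          ⊎-dec ((x , false) ∈L? a ×-dec (x , false) ∈L? c))
... | yes (x , inj₁ l∈a∩c) = yes ((x , true)  , l∈a∩c)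
... | yes (x , inj₂ l∈a∩c) = yes ((x , false) , l∈a∩c)
... | no  ∄x = no λ { ((x , true)  , l∈a∩c) → ∄x (x , inj₁ l∈a∩c)
                    ; ((x , false) , l∈a∩c) → ∄x (x , inj₂ l∈a∩c) }

∈L-Occurs : ∀ {n} {F : Formula n} {c : Clause n} (x : Fin n) (p : Bool) →
            c ∈ F → (x , p) ∈L c → Occurs x F
∈L-Occurs x true  c∈F x∈c  = _ , c∈F , inj₁ x∈c
∈L-Occurs x false c∈F ¬x∈c = _ , c∈F , inj₂ ¬x∈c

-- Completeness only constrains each variable's pair of flags separately.
CompleteAt : ∀ {n} → Formula n → Fin n → Bool × Bool → Set
CompleteAt F x u =
  (∀ p → flag p u ≡ true → ¬ flag (not p) u ≡ true) ×
  (Occurs x F → flag true u ≡ true ⊎ flag false u ≡ true) ×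
  (∀ p → flag p u ≡ true → Occurs x F)

module _ {n : ℕ} {F : Formula n} where

  Complete⇒CompleteAt : ∀ a → Complete F a → ∀ x → CompleteAt F x (lookup a x)
  Complete⇒CompleteAt _ (consistent , covers , occurring) x =
    (λ p → consistent (x , p)) , covers x , (λ p → occurring (x , p))

  CompleteAt⇒Complete : ∀ a → (∀ x → CompleteAt F x (lookup a x)) → Complete F a
  CompleteAt⇒Complete _ complete =
    (λ { (x , p) → proj₁ (complete x) p }) ,
    (λ x → proj₁ (proj₂ (complete x))) ,
    (λ { (x , p) → proj₂ (proj₂ (complete x)) p })

  Complete-updateAt : ∀ a b (x : Fin n) {f : Bool × Bool → Bool × Bool} →
                      Complete F a → Complete F b → f (lookup a x) ≡ lookup b x →
                      Complete F (updateAt a x f)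
  Complete-updateAt a b x {f} ca cb fa≡b = CompleteAt⇒Complete (updateAt a x f) completeAt
    where
    completeAt : ∀ y → CompleteAt F y (lookup (updateAt a x f) y)
    completeAt y with y ≟F x
    ... | yes refl = subst (CompleteAt F x) (sym (trans (lookup∘updateAt x a) fa≡b))
                           (Complete⇒CompleteAt b cb x)
    ... | no  y≢x  = subst (CompleteAt F y) (sym (lookup∘updateAt′ y x y≢x a))
                           (Complete⇒CompleteAt a ca y)

  neg-∈L : ∀ a → Complete F a → (l : Lit n) → Occurs (proj₁ l) F → l ∉L a → neg l ∈L a
  neg-∈L _ (_ , covers , _) (x , true)  occ x∉a  with covers x occ
  ... | inj₁ x∈a  = ⊥-elim (x∉a x∈a)
  ... | inj₂ ¬x∈a = ¬x∈a
  neg-∈L _ (_ , covers , _) (x , false) occ ¬x∉a with covers x occ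
  ... | inj₁ x∈a  = x∈a
  ... | inj₂ ¬x∈a = ⊥-elim (¬x∉a ¬x∈a)

flip-flags : (p : Bool) (u v : Bool × Bool) →
             flag (not p) u ≡ true → ¬ flag p u ≡ true →
             flag p v ≡ true → ¬ flag (not p) v ≡ true →
             setFlag (not (not p)) true (setFlag (not p) false u) ≡ v
flip-flags true  (false , true) (true , false) _ _ _ _ = refl
flip-flags true  (true , _)  _ _ p∉u _ _ = ⊥-elim (p∉u refl)
flip-flags true  (_ , false) _ () _ _ _
flip-flags true  _ (false , _) _ _ () _
flip-flags true  _ (_ , true)  _ _ _ ¬p∉v = ⊥-elim (¬p∉v refl)
flip-flags false (true , false) (false , true) _ _ _ _ = refl
flip-flags false (_ , true)  _ _ p∉u _ _ = ⊥-elim (p∉u refl)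
flip-flags false (false , _) _ () _ _ _
flip-flags false _ (_ , false) _ _ () _
flip-flags false _ (true , _)  _ _ _ ¬p∉v = ⊥-elim (¬p∉v refl)

module _ {n : ℕ} {F : Formula n} where

  rotate-towards : ∀ a b {c} → Complete F a → Complete F b →
                   InUnsat F a c → SatClause b c →
                   ∃[ a′ ] (RotEdge F a a′ × hamming a′ b < hamming a b)
  rotate-towards a b {c} ca cb (c∈F , a⊭c) ((x , p) , l∈b , l∈c) =
    a′ , (ca , ca′ , (x , p) , (c , (c∈F , a⊭c) , l∈c) , refl) ,
    hamming-updateAt-< a b x agrees differs
    where
    l∉a : (x , p) ∉L a
    l∉a l∈a = a⊭c ((x , p) , l∈a , l∈c)

    a′ : Assignment n
    a′ = flip a (neg (x , p))

    agrees : setFlag (not (not p)) true (setFlag (not p) false (lookup a x)) ≡ lookup b x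
    agrees = flip-flags p (lookup a x) (lookup b x)
               (neg-∈L a ca (x , p) (∈L-Occurs x p c∈F l∈c) l∉a) l∉a
               l∈b (proj₁ cb (x , p) l∈b)

    differs : lookup a x ≢ lookup b x
    differs ax≡bx = l∉a (subst (λ u → flag p u ≡ true) (sym ax≡bx) l∈b)

    ca′ : Complete F a′
    ca′ = Complete-updateAt a b x ca cb agrees

  module _ {cⱼ : Clause n} where

    SatAllBut : Assignment n → Set
    SatAllBut a = ∀ c → c ∈ F → c ≢ cⱼ → SatClause a c

    SatAllBut-or-InUnsat : ∀ a → SatAllBut a ⊎ ∃[ c ] (c ≢ cⱼ × InUnsat F a c)
    SatAllBut-or-InUnsat a
      with anyᴸ? (λ c → ¬? (c ≟ᶜ cⱼ) ×-dec ¬? (satClause? a c)) F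
    ... | yes ∃c = let c , c∈F , c≢cⱼ , a⊭c = find ∃c in inj₂ (c , c≢cⱼ , c∈F , a⊭c)
    ... | no  ∄c = inj₁ satAllBut
      where
      satAllBut : SatAllBut a
      satAllBut c c∈F c≢cⱼ with satClause? a c
      ... | yes a⊨c = a⊨c
      ... | no  a⊭c = ⊥-elim (∄c (lose c∈F (c≢cⱼ , a⊭c)))

    SatAllBut⇒IsAssoc : Unsatisfiable F → ∀ a → Complete F a → SatAllBut a → IsAssoc F cⱼ a
    SatAllBut⇒IsAssoc unsat a ca satAllBut = ca , satAllBut , λ a⊨cⱼ → unsat (a , ca , satAll a⊨cⱼ)
      where
      satAll : SatClause a cⱼ → SatFormula a F
      satAll a⊨cⱼ c c∈F with c ≟ᶜ cⱼ
      ... | yes refl  = a⊨cⱼ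
      ... | no  c≢cⱼ  = satAllBut c c∈F c≢cⱼ

    path-to-assoc : Unsatisfiable F → ∀ {b} → IsAssoc F cⱼ b →
                    ∀ a → Acc _<_ (hamming a b) → Complete F a →
                    ∃[ aⱼ ] (IsAssoc F cⱼ aⱼ × RotPath F a aⱼ)
    path-to-assoc unsat {b} b-assoc@(cb , b⊨others , _) a (acc closer) ca
      with SatAllBut-or-InUnsat a
    ... | inj₁ satAllBut = a , SatAllBut⇒IsAssoc unsat a ca satAllBut , ε
    ... | inj₂ (c , c≢cⱼ , c-unsat@(c∈F , _))
      with rotate-towards a b ca cb c-unsat (b⊨others c c∈F c≢cⱼ)
    ... | a′ , edge@(_ , ca′ , _) , a′<a
      with path-to-assoc unsat b-assoc a′ (closer a′<a) ca′
    ... | aⱼ , aⱼ-assoc , path = aⱼ , aⱼ-assoc , edge ◅ path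

lemma3 : (n : ℕ) (F : Formula n) → WellFormed F → Unsatisfiable F →
         (aᵢ : Assignment n) → Complete F aᵢ →
         (cᵢ : Clause n) → InUnsat F aᵢ cᵢ →
         (cⱼ : Clause n) → cⱼ ∈ F → (∃[ a ] IsAssoc F cⱼ a) →
         ∃[ aⱼ ] (IsAssoc F cⱼ aⱼ × RotPath F aᵢ aⱼ)
lemma3 n F _ unsat aᵢ caᵢ _ _ cⱼ _ (b , b-assoc) =
  path-to-assoc unsat b-assoc aᵢ (<-wellFounded (hamming aᵢ b)) caᵢ
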